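{- Let $G$ be a biconnected undirected graph that is not a single edge, and let $\mathcal{T}$ be its SPQR tree. For every set $S$ of three elements of $G$, there exists a component of $\mathcal{T}$ that is central with respect to $S$.
   Context: Elements of a graph are its vertices and edges. The SPQR tree $\mathcal{T}=\mathcal{T}(G)$ of a biconnected graph $G$ (not a single edge) is the standard decomposition of $G$ into triconnected components (Di Battista–Tamassia, in the version without Q-nodes, considered unrooted): its nodes are components, each of type S (a cycle), P (a multigraph on two vertices with at least three parallel edges) or R (a simple triconnected graph on at least four vertices). Each component consists of vertices of $G$, some edges of $G$ (called real edges) and virtual edges; every edge of $G$ is a real edge of exactly one component; every virtual edge occurs in exactly two components, and these two components are joined by the tree edge of $\mathcal{T}$ corresponding to that virtual edge. For a virtual edge $e=(a,b)$ of a component $C$, with corresponding tree edge $(C,C')$, let $B(C,e)$ be the subtree of $\mathcal{T}$ containing $C'$ after removing the tree edge $(C,C')$, and let $G(C,e)$ be the subgraph of $G$ formed by all vertices and real edges occurring in the components of $B(C,e)$. The real elements of $C$ are its vertices and real edges. For an element $x$ of $G$ and a component $C$, the representative $r_C(x)$ is $x$ itself if $x$ is a real element of $C$, and otherwise the unique virtual edge $e=(a,b)$ of $C$ such that $x$ is an element of $G(C,e)$ other than $a,b$. A component $C$ is central with respect to a set $S$ of elements of $G$ if the representatives $r_C(x)$, $x\in S$, are pairwise distinct. -}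

module Defs where

open import Data.Nat using (ℕ; suc; _+_; _≤_; NonZero)
open import Data.Nat.DivMod using (_mod_)
open import Data.Fin using (Fin; toℕ)
open import Data.Fin.Subset using (Subset; _∈_)
open import Data.Product using (Σ; ∃; ∃-syntax; _×_; _,_; proj₁; proj₂)
open import Data.Sum using (_⊎_; inj₁; inj₂; [_,_])
open import Data.Unit using (⊤)
open import Relation.Nullary using (¬_)
open import Relation.Binary.PropositionalEquality using (_≡_; _≢_)
open import Function.Definitions using (Injective)

data Walk {V : Set} (Adj : V → V → Set) (P : V → Set) : V → V → Set where
  here : ∀ {u} → P u → Walk Adj P u u
  step : ∀ {u v w} → P u → Adj u v → Walk Adj P v w → Walk Adj P u w

ConnectedOn : {V : Set} → (V → V → Set) → (V → Set) → Set
ConnectedOn {V} Adj P = ∀ (u v : V) → P u → P v → Walk Adj P u v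

SameEnds : {A : Set} → A × A → A × A → Set
SameEnds (a , b) (c , d) = (a ≡ c × b ≡ d) ⊎ (a ≡ d × b ≡ c)

-- Finite loopless undirected multigraphs
-- vertices : Fin n, edges : Fin m, each edge with its two (distinct) ends.

record Graph : Set where
  field
    n        : ℕ
    m        : ℕ
    ends     : Fin m → Fin n × Fin n
    loopless : ∀ e → proj₁ (ends e) ≢ proj₂ (ends e)
open Graph public

Adjacent : (G : Graph) → Fin (n G) → Fin (n G) → Set
Adjacent G u v = ∃[ e ] SameEnds (ends G e) (u , v)

Biconnected : Graph → Set
Biconnected G =
  (2 ≤ n G)
  × ConnectedOn (Adjacent G) (λ _ → ⊤)
  × (∀ x → ConnectedOn (Adjacent G) (λ v → v ≢ x))

SingleEdge : Graph → Set
SingleEdge G = (n G ≡ 2) × (m G ≡ 1)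

Elem : Graph → Set
Elem G = Fin (n G) ⊎ Fin (m G)

data Kind : Set where
  S P R : Kind

csuc : ∀ {L} .{{_ : NonZero L}} → Fin L → Fin L
csuc {L} i = suc (toℕ i) mod L

-- Tree edge f joins components tend f and carries the virtual edge
-- with endpoints vend f (vertices of G), which occurs in exactly these two
-- components.  Component C has vertex set bag C ⊆ V(G); each edge e of G
-- is a real edge of exactly one component, home e.
record Decomposition (G : Graph) : Set where
  field
    k    : ℕ
    t    : ℕ
    tend : Fin t → Fin k × Fin k
    kind : Fin k → Kind
    bag  : Fin k → Subset (n G)
    home : Fin (m G) → Fin k
    vend : Fin t → Fin (n G) × Fin (n G)

  InBag : Fin k → Fin (n G) → Set
  InBag C v = v ∈ bag C

  TreeAdj : Fin k → Fin k → Set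
  TreeAdj C D = ∃[ f ] SameEnds (tend f) (C , D)

  Incident : Fin t → Fin k → Set
  Incident f C = (proj₁ (tend f) ≡ C) ⊎ (proj₂ (tend f) ≡ C)

  -- skeleton edges: real edges (inj₁) and virtual edges (inj₂)
  SkEdge : Set
  SkEdge = Fin (m G) ⊎ Fin t

  skEnds : SkEdge → Fin (n G) × Fin (n G)
  skEnds = [ ends G , vend ]

  OnSkel : Fin k → SkEdge → Set
  OnSkel C (inj₁ e) = home e ≡ C
  OnSkel C (inj₂ f) = Incident f C

  SkAdj : Fin k → Fin (n G) → Fin (n G) → Set
  SkAdj C u v = ∃[ s ] (OnSkel C s × SameEnds (skEnds s) (u , v))

  IsCycle : Fin k → Set
  IsCycle C = Σ ℕ λ L' → let L = suc (suc (suc L')) in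
    Σ (Fin L → Fin (n G)) λ σ → Σ (Fin L → SkEdge) λ τ →
      Injective _≡_ _≡_ σ
      × (∀ v → InBag C v → ∃[ i ] σ i ≡ v)
      × (∀ i → InBag C (σ i))
      × Injective _≡_ _≡_ τ
      × (∀ i → OnSkel C (τ i))
      × (∀ s → OnSkel C s → ∃[ i ] τ i ≡ s)
      × (∀ i → SameEnds (skEnds (τ i)) (σ i , σ (csuc i)))

  IsBond : Fin k → Set
  IsBond C = Σ (Fin (n G)) λ a → Σ (Fin (n G)) λ b →
      a ≢ b
      × (∀ v → InBag C v → (v ≡ a) ⊎ (v ≡ b))
      × InBag C a × InBag C b
      × (∀ s → OnSkel C s → SameEnds (skEnds s) (a , b))
      × Σ (Fin 3 → SkEdge) (λ τ → Injective _≡_ _≡_ τ × (∀ i → OnSkel C (τ i)))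

  IsTriconnected : Fin k → Set
  IsTriconnected C =
      Σ (Fin 4 → Fin (n G)) (λ σ → Injective _≡_ _≡_ σ × (∀ i → InBag C (σ i)))
      × (∀ s s' → OnSkel C s → OnSkel C s' → SameEnds (skEnds s) (skEnds s') → s ≡ s')
      × (∀ x y → ConnectedOn (SkAdj C) (λ v → InBag C v × v ≢ x × v ≢ y))

  KindOK : Fin k → Set
  KindOK C with kind C
  ... | S = IsCycle C
  ... | P = IsBond C
  ... | R = IsTriconnected C

  TreeAdjWithout : Fin t → Fin k → Fin k → Set
  TreeAdjWithout f C D = ∃[ g ] (g ≢ f × SameEnds (tend g) (C , D))

  InBranch : Fin k → Fin t → Fin k → Set
  InBranch C f D = ∃[ C' ] (SameEnds (tend f) (C , C')
                            × Walk (TreeAdjWithout f) (λ _ → ⊤) C' D)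

  Real : Fin k → Elem G → Set
  Real D (inj₁ v) = InBag D v
  Real D (inj₂ e) = home e ≡ D

  InSub : Fin k → Fin t → Elem G → Set
  InSub C f x = ∃[ D ] (InBranch C f D × Real D x)

  IsVEnd : Fin t → Elem G → Set
  IsVEnd f x = (x ≡ inj₁ (proj₁ (vend f))) ⊎ (x ≡ inj₁ (proj₂ (vend f)))

  -- representatives: a real element of C, or a virtual edge (tree edge) of C
  Repr : Set
  Repr = Elem G ⊎ Fin t

  data Rep (C : Fin k) (x : Elem G) : Repr → Set where
    real : Real C x → Rep C x (inj₁ x)
    virt : ∀ f → ¬ Real C x → Incident f C → InSub C f x → ¬ IsVEnd f x
         → Rep C x (inj₂ f)

  Central3 : Fin k → Elem G → Elem G → Elem G → Set
  Central3 C x₁ x₂ x₃ =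
    Σ Repr λ r₁ → Σ Repr λ r₂ → Σ Repr λ r₃ →
      Rep C x₁ r₁ × Rep C x₂ r₂ × Rep C x₃ r₃
      × r₁ ≢ r₂ × r₁ ≢ r₃ × r₂ ≢ r₃

-- The SPQR tree of G: the decomposition tree into cycles (S), bonds (P)
-- and simple triconnected graphs (R), glued by 2-sums along virtual edges,
-- with no two adjacent S-nodes and no two adjacent P-nodes (this
-- determines it uniquely).
record IsSPQRTree (G : Graph) (T : Decomposition G) : Set where
  open Decomposition T
  field
    treeConnected : ConnectedOn TreeAdj (λ _ → ⊤)
    treeEdges     : t + 1 ≡ k
    cover         : ∀ v → ∃[ C ] InBag C v
    realInBag     : ∀ e → InBag (home e) (proj₁ (ends G e)) × InBag (home e) (proj₂ (ends G e))
    virtLoopless  : ∀ f → proj₁ (vend f) ≢ proj₂ (vend f)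
    virtShared    : ∀ f v → (InBag (proj₁ (tend f)) v × InBag (proj₂ (tend f)) v)
                          → (v ≡ proj₁ (vend f)) ⊎ (v ≡ proj₂ (vend f))
    virtEnds      : ∀ f → InBag (proj₁ (tend f)) (proj₁ (vend f)) × InBag (proj₁ (tend f)) (proj₂ (vend f))
                        × InBag (proj₂ (tend f)) (proj₁ (vend f)) × InBag (proj₂ (tend f)) (proj₂ (vend f))
    runningInt    : ∀ v → ConnectedOn TreeAdj (λ C → InBag C v)
    kindOK        : ∀ C → KindOK C
    noSS          : ∀ f → ¬ (kind (proj₁ (tend f)) ≡ S × kind (proj₂ (tend f)) ≡ S)
    noPP          : ∀ f → ¬ (kind (proj₁ (tend f)) ≡ P × kind (proj₂ (tend f)) ≡ P)

module Submission where

open import Defs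
open import Data.Fin using (Fin; _≟_)
open import Data.Fin.Subset.Properties using (_∈?_)
open import Data.Nat using (ℕ; suc; _+_; _<_; s≤s)
open import Data.Nat.Induction using (<-wellFounded)
open import Data.Nat.Properties using (≤-refl; ≤-reflexive; m<n⇒m<1+n; +-monoˡ-<; +-monoʳ-<)
open import Data.Nat.Tactic.RingSolver using (solve-∀)
open import Data.Product using (∃-syntax; _×_; _,_; proj₁; proj₂)
open import Data.Sum using (_⊎_; inj₁; inj₂)
open import Data.Sum.Properties using (inj₁-injective; inj₂-injective)
open import Data.Unit using (⊤; tt)
open import Induction.WellFounded using (Acc; acc)
open import Relation.Nullary using (¬_; Dec; yes; no)
open import Relation.Binary.PropositionalEquality using (_≡_; _≢_; refl; sym; trans)

-- Start in any component C with tree walks to components containing x₁, x₂, x₃.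
-- An element not real in C leaves C through the first tree edge g of its walk;
-- if the walk never crosses g again, the element lies in G(C,g) and g is its
-- representative, and if it does, the walk can be shortened.  When two elements
-- leave through the same g, moving C across g shortens both of their walks and
-- lengthens the third by one, so the total length drops.  This uses only that T
-- is a connected decomposition covering G, not that G is biconnected.

module _ {A : Set} {p : A × A} {a b : A} where

  SameEnds-swap : SameEnds p (a , b) → SameEnds p (b , a)
  SameEnds-swap (inj₁ eqs) = inj₂ eqs
  SameEnds-swap (inj₂ eqs) = inj₁ eqs

  SameEnds-cancelˡ : ∀ {c} → SameEnds p (a , b) → SameEnds p (a , c) → b ≡ c
  SameEnds-cancelˡ (inj₁ (_ , e₂)) (inj₁ (_ , e₂′)) = trans (sym e₂) e₂′
  SameEnds-cancelˡ (inj₁ (e₁ , e₂)) (inj₂ (e₁′ , e₂′)) = trans (sym e₂) (trans e₂′ (trans (sym e₁) e₁′))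
  SameEnds-cancelˡ (inj₂ (e₁ , e₂)) (inj₁ (e₁′ , e₂′)) = trans (sym e₁) (trans e₁′ (trans (sym e₂) e₂′))
  SameEnds-cancelˡ (inj₂ (e₁ , _)) (inj₂ (e₁′ , _)) = trans (sym e₁) e₁′

  SameEnds-endˡ : SameEnds p (a , b) → (proj₁ p ≡ a) ⊎ (proj₂ p ≡ a)
  SameEnds-endˡ (inj₁ (e₁ , _)) = inj₁ e₁
  SameEnds-endˡ (inj₂ (_ , e₂)) = inj₂ e₂

  SameEnds-endʳ : SameEnds p (a , b) → (proj₁ p ≡ b) ⊎ (proj₂ p ≡ b)
  SameEnds-endʳ (inj₁ (_ , e₂)) = inj₂ e₂
  SameEnds-endʳ (inj₂ (e₁ , _)) = inj₁ e₁

  SameEnds-end⇒ : ∀ {x} → SameEnds p (a , b) → (proj₁ p ≡ x) ⊎ (proj₂ p ≡ x) → (x ≡ a) ⊎ (x ≡ b)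
  SameEnds-end⇒ (inj₁ (e₁ , _)) (inj₁ r) = inj₁ (trans (sym r) e₁)
  SameEnds-end⇒ (inj₁ (_ , e₂)) (inj₂ r) = inj₂ (trans (sym r) e₂)
  SameEnds-end⇒ (inj₂ (e₁ , _)) (inj₁ r) = inj₂ (trans (sym r) e₁)
  SameEnds-end⇒ (inj₂ (_ , e₂)) (inj₂ r) = inj₁ (trans (sym r) e₂)

+-merge₁₂ : ∀ a b c → suc (a + b + suc c) ≡ suc a + suc b + c
+-merge₁₂ = solve-∀

+-merge₁₃ : ∀ a b c → suc (a + suc b + c) ≡ suc a + b + suc c
+-merge₁₃ = solve-∀

+-merge₂₃ : ∀ a b c → suc (suc a + b + c) ≡ a + suc b + suc c
+-merge₂₃ = solve-∀

module Branches {G : Graph} (T : Decomposition G) where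
  open Decomposition T

  data TreeWalk : ℕ → Fin k → Fin k → Set where
    []  : ∀ {C} → TreeWalk 0 C C
    _∷_ : ∀ {l C D E} → TreeAdj C D → TreeWalk l D E → TreeWalk (suc l) C E

  fromWalk : ∀ {C D} → Walk TreeAdj (λ _ → ⊤) C D → ∃[ l ] TreeWalk l C D
  fromWalk (here _) = 0 , []
  fromWalk (step _ adj w) with fromWalk w
  ... | l , w′ = suc l , adj ∷ w′

  avoidOrShortcut : ∀ g {l C D} → TreeWalk l C D
                  → Walk (TreeAdjWithout g) (λ _ → ⊤) C D
                    ⊎ ∃[ X ] Incident g X × ∃[ l′ ] l′ < l × TreeWalk l′ X D
  avoidOrShortcut g [] = inj₁ (here tt)
  avoidOrShortcut g ((g′ , se) ∷ w) with g′ ≟ g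
  ... | yes refl = inj₂ (_ , SameEnds-endʳ se , _ , ≤-refl , w)
  ... | no g′≢g with avoidOrShortcut g w
  ...   | inj₁ avoid = inj₁ (step tt (g′ , g′≢g , se) avoid)
  ...   | inj₂ (X , inc , l′ , l′<l , w′) = inj₂ (X , inc , l′ , m<n⇒m<1+n l′<l , w′)

  Reach : Fin k → Elem G → ℕ → Set
  Reach C x l = ∃[ D ] Real D x × TreeWalk l C D

  real? : ∀ C x → Dec (Real C x)
  real? C (inj₁ v) = v ∈? bag C
  real? C (inj₂ e) = home e ≟ C

  data Position (C : Fin k) (x : Elem G) : ℕ → Set where
    inside : ∀ {l} → Real C x → Position C x l
    beyond : ∀ {l} g {C′} → SameEnds (tend g) (C , C′) → ¬ Real C x → InSub C g x
           → Reach C′ x l → Position C x (suc l)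

  locate : ∀ {C x l} → Reach C x l → Position C x l ⊎ ∃[ l′ ] l′ < l × Reach C x l′
  locate (D , rD , []) = inj₁ (inside rD)
  locate {C} {x} (D , rD , (g , se) ∷ w) with real? C x
  ... | yes r = inj₁ (inside r)
  ... | no ¬r with avoidOrShortcut g w
  ...   | inj₁ avoid = inj₁ (beyond g se ¬r (D , (_ , se , avoid) , rD) (D , rD , w))
  ...   | inj₂ (X , inc , l′ , l′<l , w′) with SameEnds-end⇒ se inc
  ...     | inj₁ refl = inj₂ (l′ , m<n⇒m<1+n l′<l , D , rD , w′)
  ...     | inj₂ refl = inj₂ (suc l′ , s≤s l′<l , D , rD , (g , se) ∷ w′)

  repr : ∀ {C x l} → Position C x l → Repr
  repr {x = x} (inside _) = inj₁ x
  repr (beyond g _ _ _ _) = inj₂ g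

  data SharedExit (C : Fin k) (x y : Elem G) : ℕ → ℕ → Set where
    shared : ∀ {l m C′} → TreeAdj C′ C → Reach C′ x l → Reach C′ y m → SharedExit C x y (suc l) (suc m)

  separate : ∀ {C x y l m} → x ≢ y → (p : Position C x l) (q : Position C y m)
           → repr p ≢ repr q ⊎ SharedExit C x y l m
  separate x≢y (inside _) (inside _) = inj₁ (λ eq → x≢y (inj₁-injective eq))
  separate x≢y (inside _) (beyond _ _ _ _ _) = inj₁ λ ()
  separate x≢y (beyond _ _ _ _ _) (inside _) = inj₁ λ ()
  separate x≢y (beyond g se _ _ rx) (beyond g′ se′ _ _ ry) with g ≟ g′
  ... | no g≢g′ = inj₁ (λ eq → g≢g′ (inj₂-injective eq))
  ... | yes refl with SameEnds-cancelˡ se se′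
  ...   | refl = inj₂ (shared (g , SameEnds-swap se) rx ry)

  stepBack : ∀ {C′ C x l} → TreeAdj C′ C → Reach C x l → Reach C′ x (suc l)
  stepBack adj (D , r , w) = D , r , adj ∷ w

module Centrality {G : Graph} {T : Decomposition G} (H : IsSPQRTree G T) where
  open Decomposition T
  open IsSPQRTree H
  open Branches T

  virtualEnd-real : ∀ {g C x} → Incident g C → IsVEnd g x → Real C x
  virtualEnd-real {g} (inj₁ refl) (inj₁ refl) = proj₁ (virtEnds g)
  virtualEnd-real {g} (inj₁ refl) (inj₂ refl) = proj₁ (proj₂ (virtEnds g))
  virtualEnd-real {g} (inj₂ refl) (inj₁ refl) = proj₁ (proj₂ (proj₂ (virtEnds g)))
  virtualEnd-real {g} (inj₂ refl) (inj₂ refl) = proj₂ (proj₂ (proj₂ (virtEnds g)))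

  repr-correct : ∀ {C x l} (p : Position C x l) → Rep C x (repr p)
  repr-correct (inside r) = real r
  repr-correct (beyond g se ¬r sub _) =
    virt g ¬r (SameEnds-endˡ se) sub (λ end → ¬r (virtualEnd-real (SameEnds-endˡ se) end))

  realComponent : ∀ x → ∃[ D ] Real D x
  realComponent (inj₁ v) = cover v
  realComponent (inj₂ e) = home e , refl

  reach : ∀ C x → ∃[ l ] Reach C x l
  reach C x =
    let (D , r) = realComponent x
        (l , w) = fromWalk (treeConnected C D tt tt)
    in l , D , r , w

  module _ {x₁ x₂ x₃ : Elem G} (x₁≢x₂ : x₁ ≢ x₂) (x₁≢x₃ : x₁ ≢ x₃) (x₂≢x₃ : x₂ ≢ x₃) where

    descend : ∀ {C l₁ l₂ l₃} → Acc _<_ (l₁ + l₂ + l₃)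
            → Reach C x₁ l₁ → Reach C x₂ l₂ → Reach C x₃ l₃ → ∃[ C ] Central3 C x₁ x₂ x₃
    descend {l₁ = l₁} {l₂} {l₃} (acc rec) r₁ r₂ r₃ with locate r₁ | locate r₂ | locate r₃
    ... | inj₂ (_ , lt , r₁′) | _ | _ = descend (rec (+-monoˡ-< l₃ (+-monoˡ-< l₂ lt))) r₁′ r₂ r₃
    ... | inj₁ _ | inj₂ (_ , lt , r₂′) | _ = descend (rec (+-monoˡ-< l₃ (+-monoʳ-< l₁ lt))) r₁ r₂′ r₃
    ... | inj₁ _ | inj₁ _ | inj₂ (_ , lt , r₃′) = descend (rec (+-monoʳ-< (l₁ + l₂) lt)) r₁ r₂ r₃′
    ... | inj₁ p₁ | inj₁ p₂ | inj₁ p₃ with separate x₁≢x₂ p₁ p₂ | separate x₁≢x₃ p₁ p₃ | separate x₂≢x₃ p₂ p₃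
    ...   | inj₂ (shared {m₁} {m₂} adj q₁ q₂) | _ | _ =
            descend (rec (≤-reflexive (+-merge₁₂ m₁ m₂ l₃))) q₁ q₂ (stepBack adj r₃)
    ...   | inj₁ _ | inj₂ (shared {m₁} {m₃} adj q₁ q₃) | _ =
            descend (rec (≤-reflexive (+-merge₁₃ m₁ l₂ m₃))) q₁ (stepBack adj r₂) q₃
    ...   | inj₁ _ | inj₁ _ | inj₂ (shared {m₂} {m₃} adj q₂ q₃) =
            descend (rec (≤-reflexive (+-merge₂₃ l₁ m₂ m₃))) (stepBack adj r₁) q₂ q₃
    ...   | inj₁ d₁₂ | inj₁ d₁₃ | inj₁ d₂₃ =
            _ , _ , _ , _ , repr-correct p₁ , repr-correct p₂ , repr-correct p₃ , d₁₂ , d₁₃ , d₂₃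

    central : ∃[ C ] Central3 C x₁ x₂ x₃
    central = descend (<-wellFounded _) (proj₂ (reach C x₁)) (proj₂ (reach C x₂)) (proj₂ (reach C x₃))
      where C = proj₁ (realComponent x₁)

lemma3 : (G : Graph) → Biconnected G → ¬ SingleEdge G
       → (T : Decomposition G) → IsSPQRTree G T
       → (x₁ x₂ x₃ : Elem G) → x₁ ≢ x₂ → x₁ ≢ x₃ → x₂ ≢ x₃
       → ∃[ C ] Decomposition.Central3 T C x₁ x₂ x₃
lemma3 G _ _ T H x₁ x₂ x₃ x₁≢x₂ x₁≢x₃ x₂≢x₃ =
  Centrality.central H x₁≢x₂ x₁≢x₃ x₂≢x₃
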